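{- Let $a\in\mathbb{Q}$, $c=-a-a^2$, $f(x)=x^2+c$. Write $a=\frac{r}{s}$ with $r,s\in\mathbb{Z}$, $\gcd(r,s)=1$, $s>0$, and for $n\ge0$ write $f^n(0)-a=\frac{r_n}{s_n}$ with $r_n,s_n\in\mathbb{Z}$, $\gcd(r_n,s_n)=1$, $s_n>0$. If $r$ is odd, then $r_n\equiv1\pmod4$ for all $n\ge2$.
   Context: $f^n$ denotes the $n$-th iterate of $f$. -}

module Defs where

open import Data.Nat using (ℕ; zero; suc)
open import Data.Integer as ℤ using (ℤ)
open import Data.Integer.Divisibility using (_∣_)
open import Data.Rational using (ℚ; _+_; _-_; _*_; -_; 0ℚ; ↥_)
open import Relation.Nullary using (¬_)

iter : {A : Set} → (A → A) → ℕ → A → A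
iter f zero    x = x
iter f (suc n) x = f (iter f n x)

cOf : ℚ → ℚ
cOf a = (- a) - (a * a)

fOf : ℚ → ℚ → ℚ
fOf c x = x * x + c

-- r_n : numerator of the reduced form of f^n(0) - a (ℚ is stored in lowest terms, positive denominator)
rSeq : ℚ → ℕ → ℤ
rSeq a n = ↥ (iter (fOf (cOf a)) n 0ℚ - a)

Odd : ℤ → Set
Odd r = ¬ (ℤ.+ 2 ∣ r)

_≡_[mod_] : ℤ → ℤ → ℤ → Set
x ≡ y [mod m ] = m ∣ (x ℤ.- y)

{-# OPTIONS --safe #-}
-- With y = x - a, the map f becomes y ↦ y² + 2a(y - 1). Writing a = r/s, this gives
-- f^n(0) - a = R n / (T n * s) with R 0 = -r, T 0 = 1 and
--   R (n+1) = R n² + 2 r T n (R n - T n s),   T (n+1) = T n² s,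
-- so T n = s^(2^n - 1). The fraction is already reduced: R 1 ≡ -r² and R (n+2) ≡ R (n+1)²
-- modulo s, so every R n is coprime to s and hence to T n * s. Thus r_n = R n. If r is odd,
-- every R n is odd, and for n ≥ 1 the product T n (R n - T n s) is even (T n is even when s is;
-- otherwise T n and R n are both odd). Hence R (n+1) ≡ R n² ≡ 1 modulo 4 for n ≥ 1.
module Submission where

open import Defs
open import Data.Nat using (ℕ; _≤_)
open import Data.Integer using (+_)
open import Data.Rational using (ℚ; ↥_)

open import Data.Nat.Base as ℕ using (zero; suc; NonZero; s≤s; z≤n)
import Data.Nat.Properties as ℕ
import Data.Nat.Divisibility as ℕ
import Data.Nat.Coprimality as ℕ
open import Data.Integer.Base as ℤ using (ℤ)
import Data.Integer.Properties as ℤ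
open import Data.Integer.Coprimality using (Coprime)
open import Data.Integer.Divisibility.Signed
  using (_∣_; divides; ∣-refl; ∣ᵤ⇒∣; ∣⇒∣ᵤ; ∣m∣n⇒∣m+n; ∣m∣n⇒∣m-n; ∣m+n∣n⇒∣m; ∣m⇒∣m*n; ∣n⇒∣m*n;
         *-monoʳ-∣)
open import Data.Product.Base using (_,_)
open import Data.Sum.Base using (_⊎_; inj₁; inj₂)
open import Data.Empty using (⊥-elim)
import Data.Rational.Base as ℚ
import Data.Rational.Properties as ℚ
import Data.Rational.Unnormalised.Base as ℚᵘ
import Data.Rational.Unnormalised.Properties as ℚᵘ
open import Relation.Binary.PropositionalEquality

coprime-*ʳ : ∀ {m n o} → ℕ.Coprime m n → ℕ.Coprime m o → ℕ.Coprime m (n ℕ.* o)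
coprime-*ʳ c₁ c₂ (d∣m , d∣no) =
  c₂ (d∣m , ℕ.coprime-divisor (λ (e∣d , e∣n) → c₁ (ℕ.∣-trans e∣d d∣m , e∣n)) d∣no)

module _ where
  open import Data.Integer.Base using (_+_; _*_; _-_; -_)
  open import Data.Integer.DivMod using (_%_; _/_; a≡a%n+[a/n]*n; n%d<d)
  open import Data.Integer.Tactic.RingSolver using (solve-∀)

  coprime-*ˡ : ∀ {i j k} → Coprime i k → Coprime j k → Coprime (i * j) k
  coprime-*ˡ {i} {j} cᵢ cⱼ = subst (λ m → ℕ.Coprime m _) (sym (ℤ.abs-* i j))
    (ℕ.sym (coprime-*ʳ (ℕ.sym cᵢ) (ℕ.sym cⱼ)))

  coprime-+-* : ∀ {i k} j → Coprime i k → Coprime (i + k * j) k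
  coprime-+-* {i} {k} j c {d} (d∣i+kj , d∣k) =
    c (∣⇒∣ᵤ (∣m+n∣n⇒∣m {+ d} {i} (∣ᵤ⇒∣ d∣i+kj) (∣m⇒∣m*n {+ d} {k} j (∣ᵤ⇒∣ d∣k))) , d∣k)

  even-or-odd : ∀ x → + 2 ∣ x ⊎ + 2 ∣ x - + 1
  even-or-odd x with x % + 2 | a≡a%n+[a/n]*n x (+ 2) | n%d<d x (+ 2)
  ... | 0           | x≡q*2   | _ = inj₁ (divides (x / + 2) (trans x≡q*2 (ℤ.+-identityˡ _)))
  ... | 1           | x≡1+q*2 | _ =
    inj₂ (divides (x / + 2) (trans (cong (_- + 1) x≡1+q*2) (cancel _)))
    where
    cancel : ∀ y → + 1 + y - + 1 ≡ y
    cancel = solve-∀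
  ... | suc (suc _) | _       | s≤s (s≤s ())

  odd⇒≡1[mod2] : ∀ {x} → Odd x → + 2 ∣ x - + 1
  odd⇒≡1[mod2] {x} x-odd with even-or-odd x
  ... | inj₁ 2∣x   = ⊥-elim (x-odd (∣⇒∣ᵤ 2∣x))
  ... | inj₂ 2∣x-1 = 2∣x-1

  odd-* : ∀ {x y} → + 2 ∣ x - + 1 → + 2 ∣ y - + 1 → + 2 ∣ x * y - + 1
  odd-* {x} {y} 2∣x-1 2∣y-1 =
    subst (+ 2 ∣_) (split x y) (∣m∣n⇒∣m+n (∣m⇒∣m*n y 2∣x-1) 2∣y-1)
    where
    split : ∀ x y → (x - + 1) * y + (y - + 1) ≡ x * y - + 1
    split = solve-∀

  odd-square : ∀ {x} → + 2 ∣ x - + 1 → + 4 ∣ x * x - + 1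
  odd-square {x} (divides q x-1≡q*2) = divides (q * q + q) (begin
    x * x - + 1                      ≡⟨ factor x ⟩
    (x - + 1) * ((x - + 1) + + 2)    ≡⟨ cong (λ z → z * (z + + 2)) x-1≡q*2 ⟩
    q * + 2 * (q * + 2 + + 2)        ≡⟨ expand q ⟩
    (q * q + q) * + 4                ∎)
    where
    open ≡-Reasoning
    factor : ∀ x → x * x - + 1 ≡ (x - + 1) * ((x - + 1) + + 2)
    factor = solve-∀
    expand : ∀ q → q * + 2 * (q * + 2 + + 2) ≡ (q * q + q) * + 4
    expand = solve-∀

module Numerator (r : ℤ) (s : ℕ) where
  open import Data.Integer.Base using (_+_; _*_; _-_; -_)
  open import Data.Integer.Tactic.RingSolver using (solve-∀)

  T : ℕ → ℕ
  T zero    = 1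
  T (suc n) = T n ℕ.* T n ℕ.* s

  T≢0 : .{{NonZero s}} → ∀ n → NonZero (T n)
  T≢0 zero    = _
  T≢0 (suc n) = ℕ.m*n≢0 (T n ℕ.* T n) s {{ℕ.m*n≢0 (T n) (T n) {{T≢0 n}} {{T≢0 n}}}}

  +T-suc : ∀ n → + T (suc n) ≡ + T n * + T n * + s
  +T-suc n = trans (ℤ.pos-* (T n ℕ.* T n) s) (cong (_* + s) (ℤ.pos-* (T n) (T n)))

  R : ℕ → ℤ
  R zero    = - r
  R (suc n) = R n * R n + (r + r) * + T n * (R n - + T n * + s)

  R-suc-minus-1 : ∀ n →
    R (suc n) - + 1 ≡ (R n * R n - + 1) + + 2 * (r * (+ T n * (R n - + T n * + s)))
  R-suc-minus-1 n = regroup (R n) r (+ T n) (R n - + T n * + s)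
    where
    regroup : ∀ x r t y → x * x + (r + r) * t * y - + 1 ≡ (x * x - + 1) + + 2 * (r * (t * y))
    regroup = solve-∀

  R-suc-suc : ∀ n → R (suc (suc n)) ≡
    R (suc n) * R (suc n) + + s * ((r + r) * (+ T n * + T n) * (R (suc n) - + T (suc n) * + s))
  R-suc-suc n = trans
    (cong (λ t → R (suc n) * R (suc n) + (r + r) * t * (R (suc n) - + T (suc n) * + s)) (+T-suc n))
    (regroup (R (suc n)) (r + r) (+ T n) (+ s) _)
    where
    regroup : ∀ x c t σ y → x * x + c * (t * t * σ) * y ≡ x * x + σ * (c * (t * t) * y)
    regroup = solve-∀

  R-coprime : Coprime r (+ s) → ∀ n → Coprime (R n) (+ s)
  R-coprime r⊥s zero          = subst (λ m → ℕ.Coprime m s) (sym (ℤ.∣-i∣≡∣i∣ r)) r⊥s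
  R-coprime r⊥s (suc zero)    = subst (λ x → Coprime x (+ s)) (sym (R₁ r (+ s)))
    (coprime-+-* {(- r) * r} {+ s} (- (r + r))
      (coprime-*ˡ {(- r)} {r} {+ s} (R-coprime r⊥s zero) r⊥s))
    where
    R₁ : ∀ r σ → - r * - r + (r + r) * + 1 * (- r - + 1 * σ) ≡ - r * r + σ * - (r + r)
    R₁ = solve-∀
  R-coprime r⊥s (suc (suc n)) = subst (λ x → Coprime x (+ s)) (sym (R-suc-suc n))
    (coprime-+-* {R (suc n) * R (suc n)} {+ s} _
      (coprime-*ˡ {R (suc n)} {R (suc n)} {+ s} (R-coprime r⊥s (suc n)) (R-coprime r⊥s (suc n))))

  R-coprime-denominator : Coprime r (+ s) → ∀ n → ℕ.Coprime ℤ.∣ R n ∣ (T n ℕ.* s)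
  R-coprime-denominator r⊥s n = coprime-*ʳ (coprime-T n) (R-coprime r⊥s n)
    where
    coprime-T : ∀ k → ℕ.Coprime ℤ.∣ R n ∣ (T k)
    coprime-T zero    = ℕ.sym (ℕ.1-coprimeTo _)
    coprime-T (suc k) = coprime-*ʳ (coprime-*ʳ (coprime-T k) (coprime-T k)) (R-coprime r⊥s n)

  module _ (r-odd : + 2 ∣ r - + 1) where

    R-odd : ∀ n → + 2 ∣ R n - + 1
    R-odd zero    = subst (+ 2 ∣_) (negate r)
      (∣m∣n⇒∣m+n (∣m⇒∣m*n (- + 1) r-odd) (∣m⇒∣m*n (- + 1) ∣-refl))
      where
      negate : ∀ r → (r - + 1) * - + 1 + + 2 * - + 1 ≡ - r - + 1
      negate = solve-∀
    R-odd (suc n) = subst (+ 2 ∣_) (sym (R-suc-minus-1 n))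
      (∣m∣n⇒∣m+n (odd-* {R n} {R n} (R-odd n) (R-odd n)) (∣m⇒∣m*n _ ∣-refl))

    T-odd : + 2 ∣ + s - + 1 → ∀ n → + 2 ∣ + T n - + 1
    T-odd s-odd zero    = divides (+ 0) refl
    T-odd s-odd (suc n) = subst (λ t → + 2 ∣ t - + 1) (sym (+T-suc n))
      (odd-* {+ T n * + T n} {+ s} (odd-* {+ T n} {+ T n} (T-odd s-odd n) (T-odd s-odd n)) s-odd)

    2∣T[R-Ts] : ∀ n → + 2 ∣ + T (suc n) * (R (suc n) - + T (suc n) * + s)
    2∣T[R-Ts] n with even-or-odd (+ s)
    ... | inj₁ 2∣s   =
      ∣m⇒∣m*n _ (subst (+ 2 ∣_) (sym (+T-suc n)) (∣n⇒∣m*n (+ T n * + T n) 2∣s))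
    ... | inj₂ 2∣s-1 = ∣n⇒∣m*n (+ T (suc n)) (subst (+ 2 ∣_) (difference (R (suc n)) _)
      (∣m∣n⇒∣m-n (R-odd (suc n)) (odd-* {+ T (suc n)} {+ s} (T-odd 2∣s-1 (suc n)) 2∣s-1)))
      where
      difference : ∀ x y → (x - + 1) - (y - + 1) ≡ x - y
      difference = solve-∀

    R≡1[mod4] : ∀ n → + 4 ∣ R (suc (suc n)) - + 1
    R≡1[mod4] n = subst (+ 4 ∣_) (sym (R-suc-minus-1 (suc n)))
      (∣m∣n⇒∣m+n (odd-square {R (suc n)} (R-odd (suc n)))
                  (*-monoʳ-∣ (+ 2) (∣n⇒∣m*n r (2∣T[R-Ts] n))))

module _ where
  open import Data.Rational.Base using (_+_; _*_; _-_; -_; 0ℚ; 1ℚ; mkℚ; toℚᵘ)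
  open import Level using (0ℓ)
  open import Relation.Nullary.Decidable using (dec⇒maybe)
  open import Tactic.RingSolver using (solve-∀)
  open import Tactic.RingSolver.Core.AlmostCommutativeRing
    using (AlmostCommutativeRing; fromCommutativeRing)

  ℚ-ring : AlmostCommutativeRing 0ℓ 0ℓ
  ℚ-ring = fromCommutativeRing ℚ.+-*-commutativeRing (λ x → dec⇒maybe (0ℚ ℚ.≟ x))

  -- Built with mkℚ rather than as i / 1, so that toℚᵘ (fromℤ i) reduces to mkℚᵘ i 0.
  fromℤ : ℤ → ℚ
  fromℤ i = mkℚ i 0 (ℕ.sym (ℕ.1-coprimeTo ℤ.∣ i ∣))

  fromℤ-homo-+ : ∀ i j → fromℤ (i ℤ.+ j) ≡ fromℤ i + fromℤ j
  fromℤ-homo-+ i j = ℚ.toℚᵘ-injective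
    (ℚᵘ.≃-trans (ℚᵘ.*≡* unit-denominators) (ℚᵘ.≃-sym (ℚ.toℚᵘ-homo-+ (fromℤ i) (fromℤ j))))
    where
    unit-denominators : (i ℤ.+ j) ℤ.* + 1 ≡ (i ℤ.* + 1 ℤ.+ j ℤ.* + 1) ℤ.* + 1
    unit-denominators =
      cong (ℤ._* + 1) (sym (cong₂ ℤ._+_ (ℤ.*-identityʳ i) (ℤ.*-identityʳ j)))

  fromℤ-homo-* : ∀ i j → fromℤ (i ℤ.* j) ≡ fromℤ i * fromℤ j
  fromℤ-homo-* i j = ℚ.toℚᵘ-injective (ℚᵘ.≃-sym (ℚ.toℚᵘ-homo-* (fromℤ i) (fromℤ j)))

  fromℤ-homo‿- : ∀ i → fromℤ (ℤ.- i) ≡ - fromℤ i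
  fromℤ-homo‿- i = ℚ.toℚᵘ-injective (ℚᵘ.≃-sym (ℚ.toℚᵘ-homo‿- (fromℤ i)))

  fromℤ-homo-- : ∀ i j → fromℤ (i ℤ.- j) ≡ fromℤ i - fromℤ j
  fromℤ-homo-- i j =
    trans (fromℤ-homo-+ i (ℤ.- j)) (cong (λ q → fromℤ i + q) (fromℤ-homo‿- j))

  ↥p⊥↧p : ∀ p → Coprime (↥ p) (ℚ.↧ p)
  ↥p⊥↧p (mkℚ _ _ n⊥d) = ℕ.recompute n⊥d

  p*↧p≡↥p : ∀ p → p * fromℤ (ℚ.↧ p) ≡ fromℤ (↥ p)
  p*↧p≡↥p p@(mkℚ n d _) = ℚ.toℚᵘ-injective
    (ℚᵘ.≃-trans (ℚ.toℚᵘ-homo-* p (fromℤ (+ suc d))) (ℚᵘ.*≡* cross))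
    where
    cross : n ℤ.* + suc d ℤ.* + 1 ≡ n ℤ.* + (suc d ℕ.* 1)
    cross = trans (ℤ.*-identityʳ _) (cong (λ e → n ℤ.* + e) (sym (ℕ.*-identityʳ (suc d))))

  p*d≡n⇒↥p≡n : ∀ p n d .{{_ : NonZero d}} →
    ℕ.Coprime ℤ.∣ n ∣ d → p * fromℤ (+ d) ≡ fromℤ n → ↥ p ≡ n
  p*d≡n⇒↥p≡n p@(mkℚ m e _) n (suc d) n⊥d p*d≡n =
    cong ↥_ (ℚ.toℚᵘ-injective {p} {mkℚ n d n⊥d} (ℚᵘ.*≡* cross))
    where
    open ≡-Reasoning
    cleared : m ℤ.* + suc d ℤ.* + 1 ≡ n ℤ.* + (suc e ℕ.* 1)
    cleared = ℚᵘ.drop-*≡* (ℚᵘ.≃-trans (ℚᵘ.≃-sym (ℚ.toℚᵘ-homo-* p (fromℤ (+ suc d))))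
                                      (ℚᵘ.≃-reflexive (cong toℚᵘ p*d≡n)))
    cross : m ℤ.* + suc d ≡ n ℤ.* + suc e
    cross = begin
      m ℤ.* + suc d            ≡⟨ ℤ.*-identityʳ _ ⟨
      m ℤ.* + suc d ℤ.* + 1    ≡⟨ cleared ⟩
      n ℤ.* + (suc e ℕ.* 1)    ≡⟨ cong (λ k → n ℤ.* + k) (ℕ.*-identityʳ (suc e)) ⟩
      n ℤ.* + suc e            ∎

  shifted-step : ∀ a x → fOf (cOf a) x - a ≡ (x - a) * (x - a) + (a + a) * ((x - a) - 1ℚ)
  shifted-step = expand
    where
    expand : ∀ a x → x * x + ((- a) - a * a) - a ≡ (x - a) * (x - a) + (a + a) * ((x - a) - 1ℚ)
    expand = solve-∀ ℚ-ring

  cleared-step : ∀ y a ρ r t σ → y * fromℤ (t ℤ.* σ) ≡ fromℤ ρ → a * fromℤ σ ≡ fromℤ r →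
    (y * y + (a + a) * (y - 1ℚ)) * fromℤ (t ℤ.* t ℤ.* σ ℤ.* σ) ≡
    fromℤ (ρ ℤ.* ρ ℤ.+ (r ℤ.+ r) ℤ.* t ℤ.* (ρ ℤ.- t ℤ.* σ))
  cleared-step y a ρ r t σ yτσ≡ρ′ aσ≡α = begin
    (y * y + (a + a) * (y - 1ℚ)) * fromℤ (t ℤ.* t ℤ.* σ ℤ.* σ)
      ≡⟨ cong (λ z → (y * y + (a + a) * (y - 1ℚ)) * z) denominator ⟩
    (y * y + (a + a) * (y - 1ℚ)) * (τ * τ * σ′ * σ′)
      ≡⟨ regroup y a τ σ′ ⟩
    (y * (τ * σ′)) * (y * (τ * σ′)) + (a * σ′ + a * σ′) * τ * (y * (τ * σ′) - τ * σ′)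
      ≡⟨ cong₂ (λ u v → u * u + (v + v) * τ * (u - τ * σ′)) yτσ′≡ρ′ aσ≡α ⟩
    ρ′ * ρ′ + (α + α) * τ * (ρ′ - τ * σ′)
      ≡⟨ numerator ⟨
    fromℤ (ρ ℤ.* ρ ℤ.+ (r ℤ.+ r) ℤ.* t ℤ.* (ρ ℤ.- t ℤ.* σ)) ∎
    where
    open ≡-Reasoning
    τ σ′ ρ′ α : ℚ
    τ = fromℤ t
    σ′ = fromℤ σ
    ρ′ = fromℤ ρ
    α = fromℤ r
    yτσ′≡ρ′ : y * (τ * σ′) ≡ ρ′
    yτσ′≡ρ′ = trans (cong (y *_) (sym (fromℤ-homo-* t σ))) yτσ≡ρ′
    denominator : fromℤ (t ℤ.* t ℤ.* σ ℤ.* σ) ≡ τ * τ * σ′ * σ′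
    denominator = begin
      fromℤ (t ℤ.* t ℤ.* σ ℤ.* σ)     ≡⟨ fromℤ-homo-* (t ℤ.* t ℤ.* σ) σ ⟩
      fromℤ (t ℤ.* t ℤ.* σ) * σ′      ≡⟨ cong (_* σ′) (fromℤ-homo-* (t ℤ.* t) σ) ⟩
      fromℤ (t ℤ.* t) * σ′ * σ′       ≡⟨ cong (λ z → z * σ′ * σ′) (fromℤ-homo-* t t) ⟩
      τ * τ * σ′ * σ′                 ∎
    numerator : fromℤ (ρ ℤ.* ρ ℤ.+ (r ℤ.+ r) ℤ.* t ℤ.* (ρ ℤ.- t ℤ.* σ)) ≡
                ρ′ * ρ′ + (α + α) * τ * (ρ′ - τ * σ′)
    numerator = begin
      fromℤ (ρ ℤ.* ρ ℤ.+ (r ℤ.+ r) ℤ.* t ℤ.* (ρ ℤ.- t ℤ.* σ))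
        ≡⟨ fromℤ-homo-+ (ρ ℤ.* ρ) ((r ℤ.+ r) ℤ.* t ℤ.* (ρ ℤ.- t ℤ.* σ)) ⟩
      fromℤ (ρ ℤ.* ρ) + fromℤ ((r ℤ.+ r) ℤ.* t ℤ.* (ρ ℤ.- t ℤ.* σ))
        ≡⟨ cong₂ _+_ (fromℤ-homo-* ρ ρ) (fromℤ-homo-* ((r ℤ.+ r) ℤ.* t) (ρ ℤ.- t ℤ.* σ)) ⟩
      ρ′ * ρ′ + fromℤ ((r ℤ.+ r) ℤ.* t) * fromℤ (ρ ℤ.- t ℤ.* σ)
        ≡⟨ cong₂ (λ u v → ρ′ * ρ′ + u * v) (fromℤ-homo-* (r ℤ.+ r) t) (fromℤ-homo-- ρ (t ℤ.* σ)) ⟩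
      ρ′ * ρ′ + fromℤ (r ℤ.+ r) * τ * (ρ′ - fromℤ (t ℤ.* σ))
        ≡⟨ cong₂ (λ u v → ρ′ * ρ′ + u * τ * (ρ′ - v)) (fromℤ-homo-+ r r) (fromℤ-homo-* t σ) ⟩
      ρ′ * ρ′ + (α + α) * τ * (ρ′ - τ * σ′) ∎
    regroup : ∀ y a τ σ → (y * y + (a + a) * (y - 1ℚ)) * (τ * τ * σ * σ) ≡
      (y * (τ * σ)) * (y * (τ * σ)) + (a * σ + a * σ) * τ * (y * (τ * σ) - τ * σ)
    regroup = solve-∀ ℚ-ring

  module Orbit (a : ℚ) where
    s : ℕ
    s = ℚ.↧ₙ a

    open Numerator (↥ a) s
    open ≡-Reasoning

    x y : ℕ → ℚ
    x n = iter (fOf (cOf a)) n 0ℚ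
    y n = x n - a

    y-cleared : ∀ n → y n * fromℤ (+ T n ℤ.* + s) ≡ fromℤ (R n)
    y-cleared zero = begin
      (0ℚ - a) * fromℤ (+ 1 ℤ.* + s)   ≡⟨ cong (λ d → (0ℚ - a) * fromℤ d) (ℤ.*-identityˡ (+ s)) ⟩
      (0ℚ - a) * fromℤ (+ s)          ≡⟨ negate-left a (fromℤ (+ s)) ⟩
      - (a * fromℤ (+ s))             ≡⟨ cong -_ (p*↧p≡↥p a) ⟩
      - fromℤ (↥ a)                   ≡⟨ fromℤ-homo‿- (↥ a) ⟨
      fromℤ (ℤ.- ↥ a)                 ∎
      where
      negate-left : ∀ a x → (0ℚ - a) * x ≡ - (a * x)
      negate-left = solve-∀ ℚ-ring
    y-cleared (suc n) = begin
      y (suc n) * fromℤ (+ T (suc n) ℤ.* + s)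
        ≡⟨ cong₂ (λ q t → q * fromℤ (t ℤ.* + s)) (shifted-step a (x n)) (+T-suc n) ⟩
      (y n * y n + (a + a) * (y n - 1ℚ)) * fromℤ (+ T n ℤ.* + T n ℤ.* + s ℤ.* + s)
        ≡⟨ cleared-step (y n) a (R n) (↥ a) (+ T n) (+ s) (y-cleared n) (p*↧p≡↥p a) ⟩
      fromℤ (R (suc n)) ∎

    rSeq≡R : ∀ n → rSeq a n ≡ R n
    rSeq≡R n = p*d≡n⇒↥p≡n (y n) (R n) (T n ℕ.* s) {{ℕ.m*n≢0 (T n) s {{T≢0 n}}}}
      (R-coprime-denominator (↥p⊥↧p a) n)
      (trans (cong (λ d → y n * fromℤ d) (ℤ.pos-* (T n) s)) (y-cleared n))

proposition5p3 : (a : ℚ) → Odd (↥ a) → (n : ℕ) → 2 ≤ n →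
    rSeq a n ≡ + 1 [mod + 4 ]
proposition5p3 a ↥a-odd (suc (suc n)) (s≤s (s≤s z≤n)) =
  ∣⇒∣ᵤ (subst (λ x → + 4 ∣ x ℤ.- + 1) (sym (Orbit.rSeq≡R a (suc (suc n))))
    (Numerator.R≡1[mod4] (↥ a) (ℚ.↧ₙ a) (odd⇒≡1[mod2] {↥ a} ↥a-odd) n))
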